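{- Let $(G,\Gamma,k)$ be a yes-instance of \textsc{Dilation $t$-Augmentation}, let $S$ be a minimal solution, and let $V_S$ be the set of end-points of the edges of $S$. Then $V_S\subseteq N^t_\Gamma(V_c)$.
   Context: Let $\Gamma$ be a finite undirected unweighted graph with vertex set $V$, and let $d_\Gamma(u,v)$ denote the shortest-path (hop) distance in $\Gamma$. A graph $G$ on the same vertex set $V$ is viewed as edge-weighted: each edge $(u,v)$ of $G$ has weight $d_\Gamma(u,v)$, and $d_G(u,v)$ denotes the weighted shortest-path distance in $G$. For a set $S$ of non-edges of $G$, $G+S=(V,E(G)\cup S)$ with the same weighting rule. \textsc{Dilation $t$-Augmentation}: given $(G,\Gamma,k)$, decide whether there is a set $S$ of at most $k$ non-edges of $G$ (a solution) such that $d_{G+S}(u,v)\le t\cdot d_\Gamma(u,v)$ for all $u,v\in V$; a minimal solution is an inclusion-minimal such set. $V_c$ is the set of vertices $u$ for which there exists $v$ with $(u,v)\in E(\Gamma)$ and $d_G(u,v)>t\cdot d_\Gamma(u,v)$ (vertices in adjacent conflict in $G$). For a graph $H$, a set $W\subseteq V(H)$ and $\ell\ge 0$, $N^\ell_H(W)$ is the set of vertices at hop (unweighted) distance at most $\ell$ in $H$ from some vertex of $W$. -}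

module Defs where

open import Data.Nat using (ℕ; zero; suc; _+_; _≤_; _<ᵇ_)
open import Data.Fin using (Fin; toℕ)
open import Data.Bool using (Bool; true; false; _∨_; _∧_; if_then_else_)
open import Data.List using (List; map; allFin)
open import Data.Nat.ListAction using (sum)
open import Data.Product using (Σ; _×_; ∃; ∃-syntax)
open import Data.Integer using (+_)
open import Data.Rational using (ℚ; _/_; _*_) renaming (_≤_ to _≤ℚ_)
open import Relation.Binary.PropositionalEquality using (_≡_; _≢_)
open import Relation.Nullary using (¬_)

ℕ→ℚ : ℕ → ℚ
ℕ→ℚ m = + m / 1

record Graph (n : ℕ) : Set where
  field
    adj    : Fin n → Fin n → Bool
    sym    : ∀ u v → adj u v ≡ adj v u
    irrefl : ∀ u → adj u u ≡ false
open Graph public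

data Walk {n : ℕ} (A : Fin n → Fin n → Bool) : Fin n → Fin n → ℕ → Set where
  here : ∀ u → Walk A u u 0
  step : ∀ {u x v ℓ} → A u x ≡ true → Walk A x v ℓ → Walk A u v (suc ℓ)

-- d_Γ(u,v) = m  (hop distance in Γ is exactly m; undefined = ∞ if disconnected)
HopDist : ∀ {n} → Graph n → Fin n → Fin n → ℕ → Set
HopDist Γ u v m = Walk (adj Γ) u v m × (∀ m' → Walk (adj Γ) u v m' → m ≤ m')

-- Weighted paths in an edge set H (a Boolean adjacency), where an edge (a,b)
-- has weight d_Γ(a,b).  WPath Γ H u v w : there is a u–v path in H of total
-- weight w.  (Edges between Γ-disconnected vertices have infinite weight and
-- therefore never occur in a finite-weight path.)
data WPath {n : ℕ} (Γ : Graph n) (H : Fin n → Fin n → Bool)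
     : Fin n → Fin n → ℕ → Set where
  here : ∀ u → WPath Γ H u u 0
  step : ∀ {u x v m w} → H u x ≡ true → HopDist Γ u x m →
         WPath Γ H x v w → WPath Γ H u v (m + w)

DistLe : ∀ {n} → Graph n → (Fin n → Fin n → Bool) → Fin n → Fin n → ℚ → Set
DistLe Γ H u v q = ∃[ w ] (WPath Γ H u v w × ℕ→ℚ w ≤ℚ q)

_∪E_ : ∀ {n} → (Fin n → Fin n → Bool) → (Fin n → Fin n → Bool) → Fin n → Fin n → Bool
(A ∪E B) u v = A u v ∨ B u v

record NonEdgeSet {n : ℕ} (G : Graph n) (S : Fin n → Fin n → Bool) : Set where
  field
    sym      : ∀ u v → S u v ≡ S v u
    noLoop   : ∀ u v → S u v ≡ true → u ≢ v
    nonEdge  : ∀ u v → S u v ≡ true → adj G u v ≡ false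

size : ∀ {n} → (Fin n → Fin n → Bool) → ℕ
size {n} S = sum (map (λ u → sum (map (λ v →
  if S u v ∧ (toℕ u <ᵇ toℕ v) then 1 else 0) (allFin n))) (allFin n))

-- d_{G+S}(u,v) ≤ t · d_Γ(u,v) for all u, v  (vacuous when d_Γ(u,v) = ∞)
Feasible : ∀ {n} → ℚ → Graph n → Graph n → (Fin n → Fin n → Bool) → Set
Feasible t G Γ S = ∀ u v m → HopDist Γ u v m →
  DistLe Γ (adj G ∪E S) u v (t * ℕ→ℚ m)

IsSolution : ∀ {n} → ℚ → Graph n → Graph n → ℕ → (Fin n → Fin n → Bool) → Set
IsSolution t G Γ k S = NonEdgeSet G S × size S ≤ k × Feasible t G Γ S

_⊆E_ : ∀ {n} → (Fin n → Fin n → Bool) → (Fin n → Fin n → Bool) → Set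
S' ⊆E S = ∀ u v → S' u v ≡ true → S u v ≡ true

IsMinimalSolution : ∀ {n} → ℚ → Graph n → Graph n → ℕ → (Fin n → Fin n → Bool) → Set
IsMinimalSolution t G Γ k S = IsSolution t G Γ k S ×
  (∀ S' → S' ⊆E S → IsSolution t G Γ k S' → S ⊆E S')

InVc : ∀ {n} → ℚ → Graph n → Graph n → Fin n → Set
InVc t G Γ u = ∃[ v ] (adj Γ u v ≡ true × ¬ DistLe Γ (adj G) u v (t * ℕ→ℚ 1))

InVS : ∀ {n} → (Fin n → Fin n → Bool) → Fin n → Set
InVS S u = ∃[ v ] (S u v ≡ true)

InNbhd : ∀ {n} → Graph n → ℚ → (Fin n → Set) → Fin n → Set
InNbhd Γ t W x = ∃[ c ] (W c × ∃[ ℓ ] (Walk (adj Γ) c x ℓ × ℕ→ℚ ℓ ≤ℚ t))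

-- Let uv ∈ S and let S ∖ u drop every edge of S at u.  By minimality S ∖ u is
-- not a solution; since dilation bounds along Γ-edges compose along shortest
-- Γ-walks, some Γ-edge xy has no path of weight ≤ t in G + (S ∖ u).  Then
-- d_G(x,y) > t, so x ∈ V_c, while the path of weight ≤ t from x to y in G + S
-- must use an edge of S at u; its prefix up to u has weight ≤ t, and the
-- weight of a path bounds the Γ-hop distance of its ends.  The case
-- distinction is constructive because bounded weighted distances are
-- decidable.

{-# OPTIONS --safe #-}
module Submission where

open import Defs
open import Data.Bool.Base using (Bool; true; false; _∨_; _∧_; if_then_else_)
open import Data.Bool.Properties using () renaming (_≟_ to _≟ᵇ_)
open import Data.Fin.Base using (Fin; toℕ)
open import Data.Fin.Properties using (_≟_; any?; sequence)
open import Data.Integer.Base as ℤ using ()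
import Data.Integer.Properties as ℤ
open import Data.List.Base using (List; []; _∷_; map; allFin)
open import Data.Nat.Base as ℕ using (ℕ; zero; suc; _+_; _≤_; _<_; z≤n; s≤s; _<ᵇ_)
import Data.Nat.Properties as ℕ
open import Data.Nat.Coprimality as C using ()
open import Data.Nat.ListAction using (sum)
open import Data.Product.Base using (_×_; _,_; proj₁; proj₂; ∃-syntax)
open import Data.Rational.Base as ℚ using (ℚ; mkℚ; *≤*; _*_) renaming (_≤_ to _≤ℚ_)
import Data.Rational.Properties as ℚ
import Data.Sum.Effectful.Left as Sumₗ
open import Data.Sum.Base using (_⊎_; inj₁; inj₂; [_,_]′)
open import Function.Base using (_∘_; id)
open import Level using (0ℓ)
open import Relation.Binary.PropositionalEquality as ≡
  using (_≡_; refl; trans; cong; cong₂; subst; subst₂)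
open import Relation.Nullary.Decidable.Core
  using (Dec; yes; no; map′; _×-dec_; _⊎-dec_; ¬?)
open import Relation.Nullary.Negation.Core using (¬_; contradiction)
open import Relation.Unary using (Decidable)

module _ {n} {A : Fin n → Fin n → Bool} where

  walk-++ : ∀ {a b c ℓ₁ ℓ₂} → Walk A a b ℓ₁ → Walk A b c ℓ₂ → Walk A a c (ℓ₁ + ℓ₂)
  walk-++ (here _)   q = q
  walk-++ (step e p) q = step e (walk-++ p q)

  walk-zero : ∀ {a b} → Walk A a b 0 → a ≡ b
  walk-zero (here _) = refl

module _ {n} {Γ : Graph n} where

  wpath-++ : ∀ {H a b c w₁ w₂} → WPath Γ H a b w₁ → WPath Γ H b c w₂ → WPath Γ H a c (w₁ + w₂)
  wpath-++ (here _) q = q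
  wpath-++ {H} {w₂ = w₂} (step {m = m} {w = w} e h p) q =
    subst (WPath Γ H _ _) (≡.sym (ℕ.+-assoc m w w₂)) (step e h (wpath-++ p q))

  wpath-mono : ∀ {H H'} → H ⊆E H' → ∀ {a b w} → WPath Γ H a b w → WPath Γ H' a b w
  wpath-mono H⊆H' (here a)     = here a
  wpath-mono H⊆H' (step e h p) = step (H⊆H' _ _ e) h (wpath-mono H⊆H' p)

  wpath⇒walk : ∀ {H a b w} → WPath Γ H a b w → Walk (adj Γ) a b w
  wpath⇒walk (here a)     = here a
  wpath⇒walk (step _ h p) = walk-++ (proj₁ h) (wpath⇒walk p)

  edge⇒HopDist : ∀ {a b} → adj Γ a b ≡ true → HopDist Γ a b 1
  edge⇒HopDist {a} {b} ab∈Γ = step ab∈Γ (here b) , shortest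
    where
    shortest : ∀ m → Walk (adj Γ) a b m → 1 ≤ m
    shortest zero w with refl ← walk-zero w =
      contradiction (trans (≡.sym ab∈Γ) (irrefl Γ a)) λ ()
    shortest (suc m) _ = s≤s z≤n

walk? : ∀ {n} (A : Fin n → Fin n → Bool) x y ℓ → Dec (Walk A x y ℓ)
walk? A x y zero    = map′ (λ { refl → here x }) walk-zero (x ≟ y)
walk? A x y (suc ℓ) = map′ (λ (z , e , p) → step e p) (λ { (step e p) → _ , e , p })
  (any? λ z → (A x z ≟ᵇ true) ×-dec walk? A z y ℓ)

hopDist? : ∀ {n} (Γ : Graph n) x y m → Dec (HopDist Γ x y m)
hopDist? Γ x y m = walk? (adj Γ) x y m ×-dec
  map′ (λ none m' p → ℕ.≮⇒≥ λ m'<m → none m'<m p)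
       (λ least {m'} m'<m p → ℕ.<⇒≱ m'<m (least m' p))
       (ℕ.allUpTo? (λ m' → ¬? (walk? (adj Γ) x y m')) m)

module _ {n} (Γ : Graph n) {H : Fin n → Fin n → Bool} (H-irrefl : ∀ a → H a a ≡ false) where

  PathWith : (ℕ → Set) → Fin n → Fin n → Set
  PathWith P x y = ∃[ w ] (WPath Γ H x y w × P w)

  FirstStepWith : ℕ → (ℕ → Set) → Fin n → Fin n → Set
  FirstStepWith B P x y = ∃[ z ] (H x z ≡ true × ∃[ m ] (m < B × HopDist Γ x z (suc m) ×
    PathWith (P ∘ (suc m +_)) z y))

  mutual
    -- H is irreflexive, so every step of a path has weight suc m and the bound B decreases.
    pathWith? : ∀ B {P} → Decidable P → (∀ {w} → P w → w ≤ B) → ∀ x y →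
                Dec (PathWith P x y)
    pathWith? B {P} P? P≤B x y =
      map′ [ stay , leave ]′ split ((x ≟ y ×-dec P? 0) ⊎-dec firstStepWith? B P? P≤B x y)
      where
      stay : x ≡ y × P 0 → PathWith P x y
      stay (refl , p) = 0 , here x , p

      leave : FirstStepWith B P x y → PathWith P x y
      leave (z , e , m , _ , h , w , q , p) = suc m + w , step e h q , p

      split : PathWith P x y → x ≡ y × P 0 ⊎ FirstStepWith B P x y
      split (_ , here _ , p) = inj₁ (refl , p)
      split (_ , step {m = zero} e h q , p) with refl ← walk-zero (proj₁ h) =
        contradiction (trans (≡.sym e) (H-irrefl x)) λ ()
      split (_ , step {m = suc m} {w = w} e h q , p) =
        inj₂ (_ , e , m , ℕ.m+n≤o⇒m≤o (suc m) (P≤B p) , h , w , q , p)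

    firstStepWith? : ∀ B {P} → Decidable P → (∀ {w} → P w → w ≤ B) → ∀ x y →
                     Dec (FirstStepWith B P x y)
    firstStepWith? zero    P? P≤B x y = no λ { (_ , _ , _ , () , _) }
    firstStepWith? (suc B) P? P≤B x y = any? λ z → (H x z ≟ᵇ true) ×-dec
      ℕ.anyUpTo? (λ m → hopDist? Γ x z (suc m) ×-dec
        pathWith? B (P? ∘ (suc m +_)) (ℕ.m+n≤o⇒n≤o m ∘ ℕ.s≤s⁻¹ ∘ P≤B) z y) (suc B)

ℕ→ℚ≡mkℚ : ∀ a → ℕ→ℚ a ≡ mkℚ (ℤ.+ a) 0 (C.sym (C.1-coprimeTo a))
ℕ→ℚ≡mkℚ a = ℚ.normalize-coprime (C.sym (C.1-coprimeTo a))

ℕ→ℚ-mono-≤ : ∀ {a b} → a ≤ b → ℕ→ℚ a ≤ℚ ℕ→ℚ b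
ℕ→ℚ-mono-≤ {a} {b} a≤b rewrite ℕ→ℚ≡mkℚ a | ℕ→ℚ≡mkℚ b =
  *≤* (subst₂ ℤ._≤_ (≡.sym (ℤ.*-identityʳ (ℤ.+ a))) (≡.sym (ℤ.*-identityʳ (ℤ.+ b)))
                    (ℤ.+≤+ a≤b))

ℕ→ℚ-homo-+ : ∀ a b → ℕ→ℚ (a + b) ≡ ℕ→ℚ a ℚ.+ ℕ→ℚ b
ℕ→ℚ-homo-+ a b rewrite ℕ→ℚ≡mkℚ a | ℕ→ℚ≡mkℚ b =
  ℚ./-cong {ℤ.+ (a + b)}
    (≡.sym (cong₂ ℤ._+_ (ℤ.*-identityʳ (ℤ.+ a)) (ℤ.*-identityʳ (ℤ.+ b)))) refl

ℕ→ℚ≤⇒≤∣↥∣ : ∀ {w} q → ℕ→ℚ w ≤ℚ q → w ≤ ℤ.∣ ℚ.↥ q ∣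
ℕ→ℚ≤⇒≤∣↥∣ {w} q w≤q rewrite ℕ→ℚ≡mkℚ w = go q w≤q
  where
  go : ∀ q → mkℚ (ℤ.+ w) 0 (C.sym (C.1-coprimeTo w)) ≤ℚ q → w ≤ ℤ.∣ ℚ.↥ q ∣
  go (mkℚ (ℤ.+ k) d _) (*≤* le) rewrite ℤ.*-identityʳ (ℤ.+ k) | ≡.sym (ℤ.pos-* w (suc d)) =
    ℕ.≤-trans (ℕ.m≤m*n w (suc d)) (ℤ.drop‿+≤+ le)
  go (mkℚ ℤ.-[1+ k ] d _) (*≤* le) rewrite ℤ.*-identityʳ ℤ.-[1+ k ] | ≡.sym (ℤ.pos-* w (suc d))
    with () ← le

DistLe? : ∀ {n} (Γ : Graph n) {H : Fin n → Fin n → Bool} → (∀ a → H a a ≡ false) →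
          ∀ q x y → Dec (DistLe Γ H x y q)
DistLe? Γ H-irrefl q = pathWith? Γ H-irrefl ℤ.∣ ℚ.↥ q ∣ (λ w → ℕ→ℚ w ℚ.≤? q) (ℕ→ℚ≤⇒≤∣↥∣ q)

EdgeFeasible : ∀ {n} → ℚ → Graph n → (Fin n → Fin n → Bool) → Set
EdgeFeasible t Γ H = ∀ x y → adj Γ x y ≡ true → DistLe Γ H x y (t * ℕ→ℚ 1)

edge-dilation⇒walk-dilation : ∀ {n} {Γ : Graph n} {H} t → EdgeFeasible t Γ H →
  ∀ {x y m} → Walk (adj Γ) x y m → DistLe Γ H x y (t * ℕ→ℚ m)
edge-dilation⇒walk-dilation t edges (here x) =
  0 , here x , ℚ.≤-reflexive (≡.sym (ℚ.*-zeroʳ t))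
edge-dilation⇒walk-dilation t edges {x} (step {x = z} {ℓ = ℓ} xz∈Γ walk)
  with edges x z xz∈Γ | edge-dilation⇒walk-dilation t edges walk
... | w₁ , p₁ , w₁≤t | w₂ , p₂ , w₂≤tℓ = w₁ + w₂ , wpath-++ p₁ p₂ , (begin
  ℕ→ℚ (w₁ + w₂)                  ≡⟨ ℕ→ℚ-homo-+ w₁ w₂ ⟩
  ℕ→ℚ w₁ ℚ.+ ℕ→ℚ w₂              ≤⟨ ℚ.+-mono-≤ w₁≤t w₂≤tℓ ⟩
  t * ℕ→ℚ 1 ℚ.+ t * ℕ→ℚ ℓ        ≡⟨ ℚ.*-distribˡ-+ t (ℕ→ℚ 1) (ℕ→ℚ ℓ) ⟨
  t * (ℕ→ℚ 1 ℚ.+ ℕ→ℚ ℓ)          ≡⟨ cong (t *_) (ℕ→ℚ-homo-+ 1 ℓ) ⟨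
  t * ℕ→ℚ (suc ℓ)                ∎)
  where open ℚ.≤-Reasoning

_∖_ : ∀ {n} → (Fin n → Fin n → Bool) → Fin n → Fin n → Fin n → Bool
(S ∖ u) a b with a ≟ u | b ≟ u
... | no _ | no _ = S a b
... | _    | _    = false

module _ {n} {S : Fin n → Fin n → Bool} {u : Fin n} where

  ∖-⊆ : (S ∖ u) ⊆E S
  ∖-⊆ a b e with a ≟ u | b ≟ u
  ... | no _ | no _ = e

  ∖-sym : (∀ a b → S a b ≡ S b a) → ∀ a b → (S ∖ u) a b ≡ (S ∖ u) b a
  ∖-sym S-sym a b with a ≟ u | b ≟ u
  ... | yes _ | yes _ = refl
  ... | yes _ | no _  = refl
  ... | no _  | yes _ = refl
  ... | no _  | no _  = S-sym a b

  ∖-removes : ∀ v → (S ∖ u) u v ≡ false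
  ∖-removes v with u ≟ u
  ... | yes _  = refl
  ... | no u≢u = contradiction refl u≢u

  ∪-∖-cases : ∀ {G a b} → (G ∪E S) a b ≡ true → (G ∪E (S ∖ u)) a b ≡ true ⊎ a ≡ u ⊎ b ≡ u
  ∪-∖-cases {a = a} {b} e with a ≟ u | b ≟ u
  ... | yes a≡u | _       = inj₂ (inj₁ a≡u)
  ... | no _    | yes b≡u = inj₂ (inj₂ b≡u)
  ... | no _    | no _    = inj₁ e

  ∖-nonEdgeSet : ∀ {G : Graph n} → NonEdgeSet G S → NonEdgeSet G (S ∖ u)
  ∖-nonEdgeSet S-nonEdges = record
    { sym     = ∖-sym (NonEdgeSet.sym S-nonEdges)
    ; noLoop  = λ a b → NonEdgeSet.noLoop S-nonEdges a b ∘ ∖-⊆ a b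
    ; nonEdge = λ a b → NonEdgeSet.nonEdge S-nonEdges a b ∘ ∖-⊆ a b
    }

  avoid-or-visit : ∀ {Γ : Graph n} {G a y w} → WPath Γ (G ∪E S) a y w →
    WPath Γ (G ∪E (S ∖ u)) a y w ⊎ ∃[ w₁ ] (w₁ ≤ w × WPath Γ (G ∪E S) a u w₁)
  avoid-or-visit (here a) = inj₁ (here a)
  avoid-or-visit {G = G} (step {m = m} e h p) with ∪-∖-cases {G} e | avoid-or-visit p
  ... | inj₂ (inj₁ refl) | _                  = inj₂ (0 , z≤n , here _)
  ... | inj₂ (inj₂ refl) | _                  = inj₂ (m + 0 , ℕ.+-monoʳ-≤ m z≤n , step e h (here _))
  ... | inj₁ e'          | inj₁ q             = inj₁ (step e' h q)
  ... | inj₁ _           | inj₂ (w₁ , le , q) = inj₂ (m + w₁ , ℕ.+-monoʳ-≤ m le , step e h q)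

sum-map-mono : ∀ {A : Set} (xs : List A) {f g : A → ℕ} → (∀ x → f x ≤ g x) →
               sum (map f xs) ≤ sum (map g xs)
sum-map-mono []       f≤g = z≤n
sum-map-mono (x ∷ xs) f≤g = ℕ.+-mono-≤ (f≤g x) (sum-map-mono xs f≤g)

indicator-mono : ∀ {b b'} → (b ≡ true → b' ≡ true) → ∀ c →
                 (if b ∧ c then 1 else 0) ≤ (if b' ∧ c then 1 else 0)
indicator-mono {false} _    c = z≤n
indicator-mono {true}  b⇒b' c rewrite b⇒b' refl = ℕ.≤-refl

size-mono : ∀ {n} {S' S : Fin n → Fin n → Bool} → S' ⊆E S → size S' ≤ size S
size-mono {n} S'⊆S = sum-map-mono (allFin n) λ a → sum-map-mono (allFin n) λ b →
  indicator-mono (S'⊆S a b) (toℕ a <ᵇ toℕ b)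

module RemovingEdgesAt {n} (t : ℚ) (G Γ : Graph n) (k : ℕ) (S : Fin n → Fin n → Bool) (u : Fin n)
  where

  ∖-solution : IsSolution t G Γ k S → EdgeFeasible t Γ (adj G ∪E (S ∖ u)) →
               IsSolution t G Γ k (S ∖ u)
  ∖-solution (S-nonEdges , S-size , _) edges =
    ∖-nonEdgeSet S-nonEdges , ℕ.≤-trans (size-mono {S' = S ∖ u} ∖-⊆) S-size ,
    λ x y m (walk , _) → edge-dilation⇒walk-dilation t edges walk

  minimal⇒∖-not-solution : ∀ {v} → IsMinimalSolution t G Γ k S → S u v ≡ true →
                           ¬ IsSolution t G Γ k (S ∖ u)
  minimal⇒∖-not-solution {v} (_ , minimal) uv∈S S∖u-solution =
    contradiction (trans (≡.sym uv∈S∖u) (∖-removes {S = S} {u} v)) λ ()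
    where
    uv∈S∖u : (S ∖ u) u v ≡ true
    uv∈S∖u = minimal (S ∖ u) (∖-⊆ {S = S}) S∖u-solution u v uv∈S

  repaired-or-near-conflict : Feasible t G Γ S → ∀ x y →
    InNbhd Γ t (InVc t G Γ) u ⊎ (adj Γ x y ≡ true → DistLe Γ (adj G ∪E (S ∖ u)) x y (t * ℕ→ℚ 1))
  repaired-or-near-conflict feasible x y with adj Γ x y in xy∈Γ
  ... | false = inj₂ λ ()
  ... | true with DistLe? Γ (irrefl G) (t * ℕ→ℚ 1) x y
  ...   | yes (w , p , w≤t) =
    inj₂ λ _ → w , wpath-mono (λ a b e → cong (_∨ (S ∖ u) a b) e) p , w≤t
  ...   | no x∈Vc with feasible x y 1 (edge⇒HopDist {Γ = Γ} xy∈Γ)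
  ...     | w , p , w≤t with avoid-or-visit {u = u} p
  ...       | inj₁ q = inj₂ λ _ → w , q , w≤t
  ...       | inj₂ (w₁ , w₁≤w , q) = inj₁ (x , (y , xy∈Γ , x∈Vc) , w₁ , wpath⇒walk q , (begin
    ℕ→ℚ w₁     ≤⟨ ℕ→ℚ-mono-≤ w₁≤w ⟩
    ℕ→ℚ w      ≤⟨ w≤t ⟩
    t * ℕ→ℚ 1  ≡⟨ ℚ.*-identityʳ t ⟩
    t          ∎))
    where open ℚ.≤-Reasoning

lemma20 : ∀ {n : ℕ} (t : ℚ) (G Γ : Graph n) (k : ℕ) (S : Fin n → Fin n → Bool) →
    IsMinimalSolution t G Γ k S →
    ∀ u → InVS S u → InNbhd Γ t (InVc t G Γ) u
lemma20 t G Γ k S minimal u (v , uv∈S) =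
  [ id , (λ edges → contradiction (∖-solution (proj₁ minimal) edges)
                                   (minimal⇒∖-not-solution minimal uv∈S)) ]′
  (sequence applicative λ x → sequence applicative
    (repaired-or-near-conflict (proj₂ (proj₂ (proj₁ minimal))) x))
  where
  open RemovingEdgesAt t G Γ k S u
  open Sumₗ (InNbhd Γ t (InVc t G Γ) u) 0ℓ using (applicative)
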